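{- Let $G$ be an abelian group (written additively) and let $b,c\in G$ be such that $0,b,c$ are pairwise distinct. Then $\{0,b,c\}$ is not avoidable unless $2b=c$, $2c=b$, or $2b=2c$.
   Context: For a set $S$ with a binary operation, a subset $U\subseteq S$ is avoidable if there is a partition $\{A,B\}$ of $S$ such that no element of $U$ is the product (here: sum) of two distinct elements of $A$ or of two distinct elements of $B$. -}

module Defs where

open import Level using (Level; _⊔_)
open import Algebra.Bundles using (AbelianGroup)
open import Data.Bool using (Bool)
open import Relation.Binary.PropositionalEquality using (_≡_)
open import Relation.Nullary using (¬_)
open import Data.Product using (Σ; _×_)
open import Data.Sum using (_⊎_)

-- A partition {A,B} of the carrier is encoded by its indicator colouring
-- χ : Carrier → Bool (A = χ⁻¹ true, B = χ⁻¹ false), which must respect the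
-- group's equality (so it is a partition of the elements of G).
module _ {c ℓ : Level} (G : AbelianGroup c ℓ) where
  open AbelianGroup G

  Avoidable : ∀ {p} → (Carrier → Set p) → Set (c ⊔ ℓ ⊔ p)
  Avoidable U =
    Σ (Carrier → Bool) λ χ →
      (∀ x y → x ≈ y → χ x ≡ χ y) ×
      (∀ u x y → U u → ¬ (x ≈ y) → χ x ≡ χ y → ¬ (x ∙ y ≈ u))

  Triple : Carrier → Carrier → Carrier → Set ℓ
  Triple b c u = (u ≈ ε) ⊎ (u ≈ b) ⊎ (u ≈ c)

-- The elements 0, b, d - b, b - d, d, read cyclically, form a 5-cycle in
-- which consecutive elements sum to b, d, 0, b, d respectively, all in
-- {0, b, d}. The hypotheses say precisely that consecutive elements are
-- distinct, so an avoiding partition would be a proper 2-colouring of an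
-- odd cycle.
{-# OPTIONS --safe #-}
module Submission where

open import Defs
open import Algebra.Bundles using (AbelianGroup)
open import Relation.Nullary using (¬_)
open import Data.Bool using (Bool; not)
open import Data.Bool.Properties using (¬-not; not-¬; not-involutive)
open import Data.Empty using (⊥)
open import Data.Product using (_,_)
open import Data.Sum using (inj₁; inj₂)
open import Function using (_∘_)
open import Relation.Binary.PropositionalEquality
  using (_≡_; _≢_; cong; module ≡-Reasoning)
import Relation.Binary.PropositionalEquality as ≡
import Algebra.Properties.AbelianGroup as AbelianGroupProperties
import Relation.Binary.Reasoning.Setoid as SetoidReasoning

no-proper-2-colouring-of-C₅ : (a b c d e : Bool) →
  a ≢ b → b ≢ c → c ≢ d → d ≢ e → e ≢ a → ⊥
no-proper-2-colouring-of-C₅ a b c d e a≢b b≢c c≢d d≢e e≢a = not-¬ ≡.refl a≡not-a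
  where
  open ≡-Reasoning
  a≡not-a : a ≡ not a
  a≡not-a = begin
    a            ≡⟨ ¬-not a≢b ⟩
    not b        ≡⟨ cong not (¬-not b≢c) ⟩
    not (not c)  ≡⟨ not-involutive c ⟩
    c            ≡⟨ ¬-not c≢d ⟩
    not d        ≡⟨ cong not (¬-not d≢e) ⟩
    not (not e)  ≡⟨ not-involutive e ⟩
    e            ≡⟨ ¬-not e≢a ⟩
    not a        ∎

module _ {c ℓ} (G : AbelianGroup c ℓ) where
  open AbelianGroup G
  open AbelianGroupProperties G
  open SetoidReasoning setoid

  x∙[y-x]≈y : ∀ x y → x ∙ (y - x) ≈ y
  x∙[y-x]≈y x y = trans (comm x (y - x)) (//-rightDividesˡ x y)

  [y-x]∙[x-y]≈ε : ∀ x y → (y - x) ∙ (x - y) ≈ ε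
  [y-x]∙[x-y]≈ε x y = trans (∙-congʳ (sym (⁻¹-anti-homo‿- x y))) (inverseˡ (x - y))

  x≈y-x⇒x∙x≈y : ∀ {x y} → x ≈ y - x → x ∙ x ≈ y
  x≈y-x⇒x∙x≈y {x} {y} eq = trans (∙-congˡ eq) (x∙[y-x]≈y x y)

  x-y≈y⇒y∙y≈x : ∀ {x y} → x - y ≈ y → y ∙ y ≈ x
  x-y≈y⇒y∙y≈x {x} {y} eq = trans (∙-congʳ (sym eq)) (//-rightDividesˡ y x)

  y-x≈x-y⇒x∙x≈y∙y : ∀ {x y} → y - x ≈ x - y → x ∙ x ≈ y ∙ y
  y-x≈x-y⇒x∙x≈y∙y {x} {y} eq = begin
    x ∙ x                 ≈⟨ ∙-congˡ (//-rightDividesˡ y x) ⟨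
    x ∙ ((x - y) ∙ y)     ≈⟨ ∙-congˡ (∙-congʳ eq) ⟨
    x ∙ ((y - x) ∙ y)     ≈⟨ assoc x (y - x) y ⟨
    (x ∙ (y - x)) ∙ y     ≈⟨ ∙-congʳ (x∙[y-x]≈y x y) ⟩
    y ∙ y                 ∎

lemma2p2 : ∀ {c ℓ} (G : AbelianGroup c ℓ) → let open AbelianGroup G in
    ∀ (b d : Carrier) →
    ¬ (ε ≈ b) → ¬ (ε ≈ d) → ¬ (b ≈ d) →
    ¬ (b ∙ b ≈ d) → ¬ (d ∙ d ≈ b) → ¬ (b ∙ b ≈ d ∙ d) →
    ¬ Avoidable G (Triple G b d)
lemma2p2 G b d ε≉b ε≉d _ bb≉d dd≉b bb≉dd (χ , _ , avoid) =
  no-proper-2-colouring-of-C₅ (χ ε) (χ b) (χ (d - b)) (χ (b - d)) (χ d)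
    (separated b∈ ε≉b                            (identityˡ b))
    (separated d∈ (bb≉d ∘ x≈y-x⇒x∙x≈y G)         (x∙[y-x]≈y G b d))
    (separated ε∈ (bb≉dd ∘ y-x≈x-y⇒x∙x≈y∙y G)    ([y-x]∙[x-y]≈ε G b d))
    (separated b∈ (dd≉b ∘ x-y≈y⇒y∙y≈x G)         (//-rightDividesˡ d b))
    (separated d∈ (ε≉d ∘ sym)                    (identityʳ d))
  where
  open AbelianGroup G
  open AbelianGroupProperties G using (//-rightDividesˡ)
  ε∈ : Triple G b d ε
  ε∈ = inj₁ refl
  b∈ : Triple G b d b
  b∈ = inj₂ (inj₁ refl)
  d∈ : Triple G b d d
  d∈ = inj₂ (inj₂ refl)
  separated : ∀ {u x y} → Triple G b d u → ¬ (x ≈ y) → x ∙ y ≈ u → χ x ≢ χ y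
  separated u∈ x≉y x∙y≈u same = avoid _ _ _ u∈ x≉y same x∙y≈u
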